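{- Let $\mathcal{G}$ be a finite quiver (self-loops allowed, at most one directed edge from any vertex to any other vertex). For any vertices $\nu_0,\nu_p$, $$W_{\mathcal{G};\nu_0\nu_p}=\bigcup_{(\nu_0\nu_1\cdots\nu_{p-1}\nu_p)\in\Pi_{\mathcal{G};\nu_0\nu_p}}\bigg(\Big(\big(\{(\nu_0\nu_1\cdots\nu_p)\}\odot A^\ast_{\mathcal{G}\setminus\{\nu_0,\dots,\nu_{p-1}\};\nu_p}\big)\odot\cdots\odot A^\ast_{\mathcal{G}\setminus\{\nu_0\};\nu_1}\Big)\odot A^\ast_{\mathcal{G};\nu_0}\bigg),$$ where for any quiver $\mathcal{H}$ (here always an induced subquiver of $\mathcal{G}$) and vertex $\mu_c$ of $\mathcal{H}$, the set $A_{\mathcal{H};\mu_c}$ is given recursively by $$A_{\mathcal{H};\mu_c}=\bigcup_{(\mu_c\mu_1\cdots\mu_{c-1}\mu_c)\in\Gamma_{\mathcal{H};\mu_c}}\bigg(\Big(\big(\{(\mu_c\mu_1\cdots\mu_{c-1}\mu_c)\}\odot A^\ast_{\mathcal{H}\setminus\{\mu_c,\mu_1,\dots,\mu_{c-2}\};\mu_{c-1}}\big)\odot\cdots\odot A^\ast_{\mathcal{H}\setminus\{\mu_c,\mu_1\};\mu_2}\Big)\odot A^\ast_{\mathcal{H}\setminus\{\mu_c\};\mu_1}\bigg),$$ the recursion terminating at a vertex $\mu$ with no neighbour in the current subquiver $\mathcal{H}'$, where $A_{\mathcal{H}';\mu}=\{(\mu\mu)\}$ if the loop $(\mu\mu)$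 exists and $A_{\mathcal{H}';\mu}=\{(\mu)\}$ otherwise. In particular, for $\nu_0=\nu_p$ one has $\Pi_{\mathcal{G};\nu_0\nu_0}=\{(\nu_0)\}$ and $W_{\mathcal{G};\nu_0\nu_0}=A^\ast_{\mathcal{G};\nu_0}$. These relations give the canonical factorization of the set $W_{\mathcal{G}}$ of all walks.
   Context: A walk of length $n\ge1$ is a sequence of contiguous edges $(\mu_0\mu_1)\cdots(\mu_{n-1}\mu_n)$ with vertex string $(\mu_0\cdots\mu_n)$; each vertex $\mu$ has a trivial walk $(\mu)$ of length $0$. A cycle (off $\mu_0$) has $\mu_0=\mu_n$; otherwise the walk is open. $W_{\mathcal{G};\alpha\omega}$ is the set of all walks from $\alpha$ to $\omega$ (including the trivial walk if $\alpha=\omega$). A simple path is an open walk whose vertices are all distinct; $\Pi_{\mathcal{G};\alpha\omega}$ is the set of simple paths from $\alpha$ to $\omega$ (for $\alpha=\omega$ it is $\{(\alpha)\}$). A simple cycle is a cycle whose internal vertices are all distinct and different from its initial vertex; $\Gamma_{\mathcal{G};\alpha}$ is the set of simple cycles off $\alpha$, including the trivial walk $(\alpha)$ and the loop $(\alpha\alpha)$ if present. $\mathcal{G}\setminus\{\alpha,\beta,\dots\}$ denotes the quiver obtained by deleting these vertices and all incident edges. Canonical couple: let $b$ be a cycle off $\beta$ and $a=(\alpha_1\cdots\alpha_k)$ a walk visiting $\beta$, with $\alpha_j=\beta$ its last appearance of $\beta$; $(a,b)$ is canonical iff (i) $a,b$ are both cycles off $\beta$, or (ii) no vertex $\alpha_i\neq\beta$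 with $i<j$ is visited by $b$. Nesting product: for canonical $(w_1,w_2)$ with $w_2$ a cycle off $\beta$, $w_1\odot w_2$ is obtained by replacing the last appearance of $\beta$ in the vertex string of $w_1$ by the whole vertex string of $w_2$; otherwise $w\odot w'=0$. For sets of walks $A,B$, $A\odot B$ is the set obtained by nesting every element of $B$ into every element of $A$ (discarding zeros). For $E\subseteq W_{\mathcal{G};\alpha\alpha}$, the Kleene star is $E^\ast=\bigcup_{i\ge0}E^i$ with $E^0=\{(\alpha)\}$ and $E^i=E^{i-1}\circ E$ (concatenation, which coincides with nesting for cycles off the same vertex). -}

module Defs where

open import Data.Nat using (ℕ)
open import Data.Fin using (Fin)
open import Data.Bool using (Bool; T)
open import Data.List using (List; []; _∷_; [_]; _++_; drop)
open import Data.List.Membership.Propositional using (_∈_; _∉_)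
open import Data.List.Relation.Unary.Unique.Propositional using (Unique)
open import Data.Product using (Σ; ∃; ∃-syntax; _×_)
open import Data.Sum using (_⊎_)
open import Relation.Binary.PropositionalEquality using (_≡_; _≢_)

-- A finite quiver on vertex set Fin n: adj u v = true iff there is a
-- (unique) directed edge u → v.  Self-loops allowed (adj v v may be true).
Quiver : ℕ → Set
Quiver n = Fin n → Fin n → Bool

-- Walks are identified with their vertex strings (nonempty lists).
-- A set of walks is a predicate on vertex strings.
WSet : ℕ → Set₁
WSet n = List (Fin n) → Set

-- Induced subquivers G \ R are represented by the list R of deleted vertices.
-- IsWalk G R w : w is the vertex string of a walk (length ≥ 0) in G \ R.
data IsWalk {n} (G : Quiver n) (R : List (Fin n)) : List (Fin n) → Set where
  trivial : ∀ {v} → v ∉ R → IsWalk G R [ v ]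
  step    : ∀ {u v vs} → u ∉ R → T (G u v) → IsWalk G R (v ∷ vs) → IsWalk G R (u ∷ v ∷ vs)

data StartsAt {n} (α : Fin n) : List (Fin n) → Set where
  starts : ∀ m → StartsAt α (α ∷ m)

data EndsAt {n} (ω : Fin n) : List (Fin n) → Set where
  ends : ∀ m → EndsAt ω (m ++ [ ω ])

data CycleOff {n} (β : Fin n) : List (Fin n) → Set where
  triv : CycleOff β [ β ]
  long : ∀ m → CycleOff β (β ∷ m ++ [ β ])

Walks : ∀ {n} → Quiver n → List (Fin n) → Fin n → Fin n → WSet n
Walks G R α ω w = IsWalk G R w × StartsAt α w × EndsAt ω w

SimplePaths : ∀ {n} → Quiver n → List (Fin n) → Fin n → Fin n → WSet n
SimplePaths G R α ω w = Walks G R α ω w × Unique w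

-- Γ_{G\R; α}: simple cycles off α, including (α) and the loop (αα) if present.
-- A simple cycle is α ∷ m ++ [α] with the internal vertices m distinct and ≠ α.
data SimpleCycles {n} (G : Quiver n) (R : List (Fin n)) (α : Fin n) : List (Fin n) → Set where
  trivCyc : α ∉ R → SimpleCycles G R α [ α ]
  cyc     : ∀ m → IsWalk G R (α ∷ m ++ [ α ]) → Unique m → α ∉ m →
            SimpleCycles G R α (α ∷ m ++ [ α ])

-- Nesting product of two walks (as a relation: Nest w₁ w₂ w means w₁ ⊙ w₂ = w ≠ 0).
-- w₂ must be a cycle off some β, w₁ = p ++ β ∷ q with that β being the last
-- appearance of β in w₁, and (w₁,w₂) canonical; the result replaces that last β
-- by the whole vertex string of w₂.
Nest : ∀ {n} → List (Fin n) → List (Fin n) → List (Fin n) → Set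
Nest {n} w₁ w₂ w =
  Σ (Fin n) λ β → CycleOff β w₂ ×
  Σ (List (Fin n)) λ p → Σ (List (Fin n)) λ q →
    (w₁ ≡ p ++ β ∷ q) × (β ∉ q) ×
    (CycleOff β w₁ ⊎ (∀ x → x ∈ p → x ≢ β → x ∉ w₂)) ×
    (w ≡ p ++ w₂ ++ q)

_⊙_ : ∀ {n} → WSet n → WSet n → WSet n
(A ⊙ B) w = ∃[ w₁ ] ∃[ w₂ ] (A w₁ × B w₂ × Nest w₁ w₂ w)

infixl 6 _⊙_

⟦_⟧ : ∀ {n} → List (Fin n) → WSet n
⟦ u ⟧ w = w ≡ u

-- Iterated nesting along a vertex list vs = (v₁ … v_k) with deleted set R:
--   NestChain S R (v₁ ∷ … ∷ v_k) X
--     = ((X ⊙ S (R ++ [v₁ … v_{k-1}]) v_k) ⊙ …) ⊙ S R v₁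
-- i.e. the star attached to v_i lives in the subquiver with R and v₁ … v_{i-1} deleted.
NestChain : ∀ {n} → (List (Fin n) → Fin n → WSet n) →
            List (Fin n) → List (Fin n) → WSet n → WSet n
NestChain S R []       X = X
NestChain S R (v ∷ vs) X = NestChain S (R ++ [ v ]) vs X ⊙ S R v

-- A_{G\R; μ} and its Kleene star A*_{G\R; μ}, defined as the least sets
-- satisfying the (well-founded) recursion of the paper.
--   A_{H;μ} = ⋃_{(μ μ₁ … μ_{c-1} μ) ∈ Γ_{H;μ}}
--               ((({c} ⊙ A*_{H∖{μ,μ₁..μ_{c-2}};μ_{c-1}}) ⊙ …) ⊙ A*_{H∖{μ};μ₁})
--   E* = ⋃_i E^i,  E^0 = {(μ)},  E^i = E^{i-1} ∘ E  (concatenation).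
mutual
  data A {n} (G : Quiver n) (R : List (Fin n)) (μ : Fin n) : List (Fin n) → Set where
    viaCycle : ∀ {w} m → SimpleCycles G R μ (μ ∷ m ++ [ μ ]) →
               NestChain (AStar G) (R ++ [ μ ]) m ⟦ μ ∷ m ++ [ μ ] ⟧ w → A G R μ w
    viaTriv  : SimpleCycles G R μ [ μ ] → A G R μ [ μ ]

  data AStar {n} (G : Quiver n) (R : List (Fin n)) (μ : Fin n) : List (Fin n) → Set where
    zero : AStar G R μ [ μ ]
    snoc : ∀ {u c} → AStar G R μ u → A G R μ c → AStar G R μ (u ++ drop 1 c)

-- Soundness: every element of A_{G∖R;μ}, of A*_{G∖R;μ} and of a nesting chain
-- over a base set of walks α ⇝ ω is again a walk (closed off μ, resp. α ⇝ ω).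
-- This follows from the fact that nesting a closed walk into a walk at one of
-- its vertices yields a walk with the same endpoints.
--
-- Completeness is proved by induction on the length of walks, for three
-- statements at once:
--   * a closed walk off μ in G∖R lies in A*_{G∖R;μ}: split it at its last
--     return to μ into a shorter closed walk followed by a primitive cycle;
--   * a primitive cycle μ x μ (μ ∉ x) lies in A_{G∖R;μ}: x is a walk of
--     G∖(R ∪ {μ}), so it factorises along a simple path, which closes up to a
--     simple cycle off μ;
--   * a walk α ⇝ ω in G∖R factorises along a simple path: split it at its last
--     visit to α into a closed walk off α (a star element) and a walk from α
--     that never returns to α, which factorises in G∖(R ∪ {α}).
-- Since the inner factorisations happen inside a longer vertex string, the
-- path statement is proved for walks framed by a prefix P and a suffix Q of
-- deleted vertices.
module Submission where

open import Defs
open import Data.Fin using (Fin)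
open import Data.List using (List; []; [_])
open import Data.Product using (∃-syntax; _×_)
open import Function.Bundles using (_⇔_)
open import Relation.Binary.PropositionalEquality using (_≡_)

open import Data.Bool using (T)
open import Data.Empty using (⊥-elim)
open import Data.Fin.Properties using (_≟_)
open import Data.List using (_∷_; _++_; drop; length)
open import Data.List.Properties using (++-assoc; ++-identityʳ; length-++; length-++-≤ˡ; length-++-≤ʳ)
open import Data.List.Membership.Propositional using (_∈_; _∉_)
open import Data.List.Membership.Propositional.Properties using (∈-++⁻)
open import Data.List.Relation.Binary.Subset.Propositional using (_⊆_)
open import Data.List.Relation.Binary.Subset.Propositional.Properties using (⊆-trans; xs⊆xs++ys; xs⊆ys++xs; ++⁺ˡ)
open import Data.List.Relation.Unary.All as All using ()
open import Data.List.Relation.Unary.AllPairs using ([]; _∷_)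
open import Data.List.Relation.Unary.Any using (here; there)
open import Data.List.Relation.Unary.Unique.Propositional using (Unique)
open import Data.Nat using (ℕ; zero; suc; _≤_; _<_; s≤s; s≤s⁻¹; z≤n)
open import Data.Nat.Properties using (≤-refl; ≤-trans; ≤-<-trans; <-≤-trans; +-monoʳ-≤; +-monoʳ-<)
open import Data.Product using (_,_; proj₁; proj₂; map₁)
open import Data.Sum using (inj₁; inj₂)
open import Function using (_∘_)
open import Function.Bundles using (mk⇔)
open import Relation.Nullary using (yes; no; contradiction)
open import Relation.Binary.PropositionalEquality using (refl; sym; trans; cong; subst; subst₂; module ≡-Reasoning)

length-prefix-≤ : ∀ {A : Set} (p : List A) {xs ys : List A} →
                  length xs ≤ length ys → length (p ++ xs) ≤ length (p ++ ys)
length-prefix-≤ p {xs} {ys} h rewrite length-++ p {xs} | length-++ p {ys} = +-monoʳ-≤ (length p) h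

length-prefix-< : ∀ {A : Set} (p : List A) {xs ys : List A} →
                  length xs < length ys → length (p ++ xs) < length (p ++ ys)
length-prefix-< p {xs} {ys} h rewrite length-++ p {xs} | length-++ p {ys} = +-monoʳ-< (length p) h

∉-++⁺ : ∀ {A : Set} {x : A} {xs ys : List A} → x ∉ xs → x ∉ ys → x ∉ xs ++ ys
∉-++⁺ {xs = xs} x∉xs x∉ys x∈ with ∈-++⁻ xs x∈
... | inj₁ x∈xs = x∉xs x∈xs
... | inj₂ x∈ys = x∉ys x∈ys

module WalkFactorisation {n : ℕ} (G : Quiver n) where

  open import Data.List.Membership.DecPropositional (_≟_ {n}) using (_∈?_)

  private
    variable
      k : ℕ
      α β μ ω u v x y : Fin n
      R R′ P Q p q w w₁ w₂ c vs xs : List (Fin n)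
      X : WSet n

  -- It packages the three conditions of `Walks` into one inductive family, so
  -- that cutting and gluing walks are structural inductions.
  data Walk (R : List (Fin n)) : Fin n → Fin n → List (Fin n) → Set where
    here : v ∉ R → Walk R v v [ v ]
    step : u ∉ R → T (G u v) → Walk R v ω (v ∷ vs) → Walk R u ω (u ∷ v ∷ vs)

  startsAt : Walk R α ω w → StartsAt α w
  startsAt (here _)     = starts []
  startsAt (step _ _ _) = starts _

  endsAt-∷ : EndsAt ω w → EndsAt ω (x ∷ w)
  endsAt-∷ (ends m) = ends (_ ∷ m)

  endsAt : Walk R α ω w → EndsAt ω w
  endsAt (here _)     = ends []
  endsAt (step _ _ t) = endsAt-∷ (endsAt t)

  isWalk : Walk R α ω w → IsWalk G R w
  isWalk (here v∉R)     = trivial v∉R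
  isWalk (step u∉R e t) = step u∉R e (isWalk t)

  startVisited : Walk R α ω w → α ∈ w
  startVisited (here _)     = here refl
  startVisited (step _ _ _) = here refl

  endVisited : Walk R α ω w → ω ∈ w
  endVisited (here _)     = here refl
  endVisited (step _ _ t) = there (endVisited t)

  avoids : Walk R α ω w → x ∈ w → x ∉ R
  avoids (here v∉R)     (here refl)  = v∉R
  avoids (here _)       (there ())
  avoids (step u∉R _ _) (here refl)  = u∉R
  avoids (step _ _ t)   (there x∈w)  = avoids t x∈w

  toWalks : Walk R α ω w → Walks G R α ω w
  toWalks t = isWalk t , startsAt t , endsAt t

  fromWalks : Walks G R α ω w → Walk R α ω w
  fromWalks (isw , st , ends m) = build m isw st
    where
      build : ∀ m → IsWalk G R (m ++ [ ω ]) → StartsAt α (m ++ [ ω ]) → Walk R α ω (m ++ [ ω ])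
      build []          (trivial v∉R)    (starts _) = here v∉R
      build (_ ∷ [])    (step x∉R e isw) (starts _) = step x∉R e (build [] isw (starts _))
      build (_ ∷ y ∷ m) (step x∉R e isw) (starts _) = step x∉R e (build (y ∷ m) isw (starts _))

  restrict : (∀ {x} → x ∈ w → x ∉ R′) → Walk R α ω w → Walk R′ α ω w
  restrict out (here _)     = here (out (here refl))
  restrict out (step _ e t) = step (out (here refl)) e (restrict (out ∘ there) t)

  weaken : R′ ⊆ R → Walk R α ω w → Walk R′ α ω w
  weaken R′⊆R t = restrict (λ x∈w x∈R′ → avoids t x∈w (R′⊆R x∈R′)) t

  deleteAvoided : Walk R α ω w → v ∉ w → Walk (R ++ [ v ]) α ω w
  deleteAvoided {R = R} t v∉w = restrict outside t
    where
      outside : ∀ {x} → x ∈ _ → x ∉ R ++ [ _ ]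
      outside x∈w x∈R++v with ∈-++⁻ R x∈R++v
      ... | inj₁ x∈R        = avoids t x∈w x∈R
      ... | inj₂ (here refl) = v∉w x∈w

  consWalk : u ∉ R → T (G u α) → Walk R α ω w → Walk R u ω (u ∷ w)
  consWalk u∉R e t@(here _)     = step u∉R e t
  consWalk u∉R e t@(step _ _ _) = step u∉R e t

  snocWalk : Walk R α ω w → T (G ω v) → v ∉ R → Walk R α v (w ++ [ v ])
  snocWalk (here x∉R)      e v∉R = step x∉R e (here v∉R)
  snocWalk (step x∉R e′ t) e v∉R = step x∉R e′ (snocWalk t e v∉R)

  concatWalk : Walk R α β w → Walk R β ω c → Walk R α ω (w ++ drop 1 c)
  concatWalk (here _)       t@(here _)     = t
  concatWalk (here _)       t@(step _ _ _) = t
  concatWalk (step x∉R e s) t              = step x∉R e (concatWalk s t)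

  splitWalk : ∀ p → Walk R α ω (p ++ β ∷ q) → Walk R α β (p ++ [ β ]) × Walk R β ω (β ∷ q)
  splitWalk []          t@(here x∉R)     = here x∉R , t
  splitWalk []          t@(step x∉R _ _) = here x∉R , t
  splitWalk (_ ∷ [])    (step x∉R e t)   = map₁ (step x∉R e) (splitWalk [] t)
  splitWalk (_ ∷ y ∷ p) (step x∉R e t)   = map₁ (step x∉R e) (splitWalk (y ∷ p) t)

  unsnocWalk : ∀ xs → Walk R α ω (x ∷ xs ++ [ v ]) → ∃[ ω′ ] (Walk R α ω′ (x ∷ xs) × T (G ω′ v))
  unsnocWalk []       (step x∉R e _) = _ , here x∉R , e
  unsnocWalk (_ ∷ xs) (step x∉R e t) with unsnocWalk xs t
  ... | ω′ , t′ , e′ = ω′ , step x∉R e t′ , e′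

  insertWalk : ∀ p → Walk R α ω (p ++ β ∷ q) → Walk R β β c → Walk R α ω (p ++ c ++ q)
  insertWalk []          t@(here _)     s = concatWalk s t
  insertWalk []          t@(step _ _ _) s = concatWalk s t
  insertWalk (_ ∷ [])    (step x∉R e t) s = consWalk x∉R e (insertWalk [] t s)
  insertWalk (_ ∷ y ∷ p) (step x∉R e t) s = step x∉R e (insertWalk (y ∷ p) t s)

  closedCycle : EndsAt μ w → StartsAt μ w → CycleOff μ w
  closedCycle (ends [])      (starts _) = triv
  closedCycle (ends (_ ∷ m)) (starts _) = long m

  cycleStart : CycleOff β w → StartsAt μ w → β ≡ μ
  cycleStart triv     (starts _) = refl
  cycleStart (long _) (starts _) = refl

  simpleCycleWalk : SimpleCycles G R μ w → Walk R μ μ w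
  simpleCycleWalk (trivCyc μ∉R)   = here μ∉R
  simpleCycleWalk (cyc m isw _ _) = fromWalks (isw , starts _ , ends (_ ∷ m))

  nestWalk : Nest w₁ w₂ w → Walk R α ω w₁ → Walk R μ μ w₂ → Walk R α ω w
  nestWalk (β , β-cycle , p , q , refl , _ , _ , refl) t s with cycleStart β-cycle (startsAt s)
  ... | refl = insertWalk p t s

  mutual
    starWalk : AStar G R μ w → Walk [] μ μ w
    starWalk zero       = here λ ()
    starWalk (snoc u c) = concatWalk (starWalk u) (primitiveWalk c)

    primitiveWalk : A G R μ w → Walk [] μ μ w
    primitiveWalk (viaCycle m sc chain) = chainWalk m (λ { refl → weaken (λ ()) (simpleCycleWalk sc) }) chain
    primitiveWalk (viaTriv _)           = here λ ()

    chainWalk : ∀ vs → (∀ {x} → X x → Walk [] α ω x) → NestChain (AStar G) R vs X w → Walk [] α ω w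
    chainWalk []       base inner = base inner
    chainWalk (_ ∷ vs) base (_ , _ , inner , star , nest) =
      nestWalk nest (chainWalk vs base inner) (starWalk star)

  lastOccurrence : ∀ w → α ∈ w → ∃[ p ] ∃[ q ] (w ≡ p ++ α ∷ q × α ∉ q)
  lastOccurrence {α} (x ∷ xs) α∈w with α ∈? xs
  ... | yes α∈xs = let (p , q , eq , α∉q) = lastOccurrence xs α∈xs in x ∷ p , q , cong (x ∷_) eq , α∉q
  ... | no α∉xs with α∈w
  ...   | here refl   = [] , xs , refl , α∉xs
  ...   | there α∈xs = contradiction α∈xs α∉xs

  lastReturn : ∀ m → ∃[ p ] ∃[ x ] (μ ∷ m ++ [ μ ] ≡ p ++ μ ∷ x ++ [ μ ] × μ ∉ x)
  lastReturn {μ} m =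
    let (p , x , eq , μ∉x) = lastOccurrence (μ ∷ m) (here refl) in
    p , x , chain p x eq , μ∉x
    where
      open ≡-Reasoning
      chain : ∀ p x → μ ∷ m ≡ p ++ μ ∷ x → μ ∷ m ++ [ μ ] ≡ p ++ μ ∷ x ++ [ μ ]
      chain p x eq = begin
        μ ∷ m ++ [ μ ]        ≡⟨ cong (_++ [ μ ]) eq ⟩
        (p ++ μ ∷ x) ++ [ μ ] ≡⟨ ++-assoc p (μ ∷ x) [ μ ] ⟩
        p ++ μ ∷ x ++ [ μ ]   ∎

  nestAfterDeleted : Walk R β β c → P ⊆ R → β ∉ q → Nest (P ++ β ∷ q) c (P ++ c ++ q)
  nestAfterDeleted s P⊆R β∉q =
    _ , closedCycle (endsAt s) (startsAt s) , _ , _ , refl , β∉q ,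
    inj₂ (λ x x∈P _ x∈c → avoids s x∈c (P⊆R x∈P)) , refl

  trivialPath : α ∉ R → SimplePaths G R α α [ α ]
  trivialPath α∉R = toWalks (here α∉R) , All.[] ∷ []

  extendPath : α ∉ R → T (G α y) → SimplePaths G (R ++ [ α ]) y ω p → SimplePaths G R α ω (α ∷ p)
  extendPath {α = α} {R = R} α∉R e (walks , unique) =
    toWalks (consWalk α∉R e (weaken (xs⊆xs++ys R [ α ]) (fromWalks walks))) ,
    All.tabulate (λ x∈p α≡x → avoids (fromWalks walks) x∈p (xs⊆ys++xs [ α ] R (here (sym α≡x)))) ∷ unique

  closeCycle : μ ∉ R → T (G μ y) → T (G ω μ) → SimplePaths G (R ++ [ μ ]) y ω p →
               SimpleCycles G R μ (μ ∷ p ++ [ μ ])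
  closeCycle {μ = μ} {R = R} μ∉R e e′ (walks , unique) =
    cyc _ (isWalk (consWalk μ∉R e (snocWalk (weaken (xs⊆xs++ys R [ μ ]) (fromWalks walks)) e′ μ∉R)))
      unique (λ μ∈p → avoids (fromWalks walks) μ∈p (xs⊆ys++xs [ μ ] R (here refl)))

  appendPrimitive : ∀ p → AStar G R μ (p ++ [ μ ]) → A G R μ (μ ∷ xs ++ [ μ ]) → AStar G R μ (p ++ μ ∷ xs ++ [ μ ])
  appendPrimitive {μ = μ} {xs = xs} p u c = subst (AStar G _ μ) (++-assoc p [ μ ] (xs ++ [ μ ])) (snoc u c)

  Factorised : List (Fin n) → Fin n → Fin n → List (Fin n) → List (Fin n) → WSet n
  Factorised R α ω P Q w =
    ∃[ π ] (SimplePaths G R α ω π × NestChain (AStar G) R π ⟦ P ++ π ++ Q ⟧ (P ++ w ++ Q))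

  PathDecomposition ClosedDecomposition PrimitiveDecomposition : ℕ → Set
  PathDecomposition k = ∀ {R α ω P Q w} → length w < k → Walk R α ω w → P ⊆ R → Q ⊆ R →
                        Factorised R α ω P Q w
  ClosedDecomposition k = ∀ {R μ w} → length w < k → Walk R μ μ w → AStar G R μ w
  PrimitiveDecomposition k = ∀ {R μ x} → length (μ ∷ x ++ [ μ ]) < k → Walk R μ μ (μ ∷ x ++ [ μ ]) →
                             μ ∉ x → A G R μ (μ ∷ x ++ [ μ ])

  -- μ x μ is a simple cycle with stars nested along it: x = y … ω is a walk of
  -- G ∖ (R ∪ {μ}), hence factorises along a simple path y ⇝ ω (framed by μ, μ).
  primitiveStep : PathDecomposition k → PrimitiveDecomposition (suc k)
  primitiveStep path {x = []} _ t _ = viaCycle [] (cyc [] (isWalk t) [] λ ()) refl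
  primitiveStep path {R = R} {μ} {y ∷ ys} bound (step μ∉R e t) μ∉x with unsnocWalk ys t
  ... | ω , t′ , e′ =
    let (π , sp , chain) = path (≤-trans (s≤s (length-++-≤ˡ (y ∷ ys))) (s≤s⁻¹ bound))
                                (deleteAvoided t′ μ∉x) (xs⊆ys++xs [ μ ] R) (xs⊆ys++xs [ μ ] R)
    in viaCycle π (closeCycle μ∉R e e′ sp) chain

  -- A nontrivial closed walk is a shorter closed walk (a star element by
  -- induction) followed by a primitive cycle.
  closedStep : ClosedDecomposition k → PrimitiveDecomposition (suc k) → ClosedDecomposition (suc k)
  closedStep {k} closed prime {R} {μ} bound t with closedCycle (endsAt t) (startsAt t)
  ... | triv   = zero
  ... | long m with lastReturn m
  ...   | p , x , eq , μ∉x =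
    subst (λ w → length w < suc k → Walk R μ μ w → AStar G R μ w) (sym eq) split bound t
    where
      split : length (p ++ μ ∷ x ++ [ μ ]) < suc k → Walk R μ μ (p ++ μ ∷ x ++ [ μ ]) →
              AStar G R μ (p ++ μ ∷ x ++ [ μ ])
      split bound′ t′ =
        appendPrimitive p
          (closed (<-≤-trans shorter (s≤s⁻¹ bound′)) (proj₁ (splitWalk p t′)))
          (prime (≤-<-trans (length-++-≤ʳ (μ ∷ x ++ [ μ ]) {p}) bound′) (proj₂ (splitWalk p t′)) μ∉x)
        where
          shorter : length (p ++ [ μ ]) < length (p ++ μ ∷ x ++ [ μ ])
          shorter = length-prefix-< p (s≤s (length-++-≤ʳ [ μ ] {x}))

  pathTail : PathDecomposition k → length q < k → Walk R α ω (α ∷ q) → α ∉ q → P ⊆ R → Q ⊆ R →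
             ∃[ π ] (SimplePaths G R α ω (α ∷ π) ×
                     NestChain (AStar G) (R ++ [ α ]) π ⟦ P ++ α ∷ π ++ Q ⟧ (P ++ α ∷ q ++ Q))
  pathTail _ _ (here α∉R) _ _ _ = [] , trivialPath α∉R , refl
  pathTail {q = q} {R = R} {α = α} {P = P} {Q = Q} path bound (step α∉R e t) α∉q P⊆R Q⊆R =
    let (π , sp , chain) = path bound (deleteAvoided t α∉q) (++⁺ˡ [ α ] P⊆R) (⊆-trans Q⊆R (xs⊆xs++ys R [ α ]))
    in π , extendPath α∉R e sp ,
       subst₂ (λ Y z → NestChain (AStar G) (R ++ [ α ]) π ⟦ Y ⟧ z)
              (++-assoc P [ α ] (π ++ Q)) (++-assoc P [ α ] (q ++ Q)) chain

  -- Cut a walk at its last visit to α: a closed walk off α (a star element)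
  -- nested canonically into the tail α ∷ q, which factorises by pathTail.
  pathStep : PathDecomposition k → ClosedDecomposition (suc k) → PathDecomposition (suc k)
  pathStep path closed {α = α} {P = P} {Q = Q} {w = w} bound t P⊆R Q⊆R with lastOccurrence w (startVisited t)
  ... | p , q , refl , α∉q =
    let (loop , rest) = splitWalk p t
        (π , sp , chain) = pathTail path (≤-trans (length-++-≤ʳ (α ∷ q) {p}) (s≤s⁻¹ bound)) rest α∉q P⊆R Q⊆R
        star = closed (≤-<-trans (length-prefix-≤ p (s≤s z≤n)) bound) loop
        α∉Q = λ α∈Q → avoids t (startVisited t) (Q⊆R α∈Q)
    in α ∷ π , sp , (_ , _ , chain , star ,
       subst (Nest _ _) (cong (P ++_) (reassociate p q)) (nestAfterDeleted loop P⊆R (∉-++⁺ α∉q α∉Q)))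
    where
      reassociate : ∀ p q → (p ++ [ α ]) ++ q ++ Q ≡ (p ++ α ∷ q) ++ Q
      reassociate p q = trans (++-assoc p [ α ] (q ++ Q)) (sym (++-assoc p (α ∷ q) Q))

  decompositions : ∀ k → PathDecomposition k × ClosedDecomposition k
  decompositions zero    = (λ ()) , (λ ())
  decompositions (suc k) =
    let (path , closed) = decompositions k
        closed′ = closedStep closed (primitiveStep path)
    in pathStep path closed′ , closed′

  factorise : Walk [] α ω w → ∃[ π ] (SimplePaths G [] α ω π × NestChain (AStar G) [] π ⟦ π ⟧ w)
  factorise {w = w} t =
    let (π , sp , chain) = proj₁ (decompositions (suc (length w))) {P = []} {Q = []} ≤-refl t (λ ()) (λ ())
    in π , sp , subst₂ (λ Y z → NestChain (AStar G) [] π ⟦ Y ⟧ z) (++-identityʳ π) (++-identityʳ w) chain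

  closedSimplePath : Walk R α α p → Unique p → p ≡ [ α ]
  closedSimplePath (here _)     _                = refl
  closedSimplePath (step _ _ t) (α∉rest ∷ _) = ⊥-elim (All.lookup α∉rest (endVisited t) refl)

  walkFactorisation : ∀ α ω w →
    Walks G [] α ω w ⇔ (∃[ π ] (SimplePaths G [] α ω π × NestChain (AStar G) [] π ⟦ π ⟧ w))
  walkFactorisation α ω w = mk⇔ (factorise ∘ fromWalks)
    (λ (π , sp , chain) → toWalks (chainWalk π (λ { refl → fromWalks (proj₁ sp) }) chain))

  closedSimplePaths : ∀ α π → SimplePaths G [] α α π ⇔ (π ≡ [ α ])
  closedSimplePaths α π = mk⇔ (λ (walks , unique) → closedSimplePath (fromWalks walks) unique)
                              (λ { refl → trivialPath λ () })

  closedWalks : ∀ μ w → Walks G [] μ μ w ⇔ AStar G [] μ w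
  closedWalks μ w = mk⇔ (λ walks → proj₂ (decompositions (suc (length w))) ≤-refl (fromWalks walks))
                        (toWalks ∘ starWalk)

theorem2 : ∀ {n} (G : Quiver n) (ν₀ νₚ : Fin n) →
    ((w : List (Fin n)) →
      Walks G [] ν₀ νₚ w ⇔
      (∃[ π ] (SimplePaths G [] ν₀ νₚ π × NestChain (AStar G) [] π ⟦ π ⟧ w)))
    × ((π : List (Fin n)) → SimplePaths G [] ν₀ ν₀ π ⇔ (π ≡ [ ν₀ ]))
    × ((w : List (Fin n)) → Walks G [] ν₀ ν₀ w ⇔ AStar G [] ν₀ w)
theorem2 G ν₀ νₚ = walkFactorisation ν₀ νₚ , closedSimplePaths ν₀ , closedWalks ν₀
  where open WalkFactorisation G
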